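{- In ordinary first-order logic $\mathcal{L}_\omega^\omega$ there are infinitely many theories any two distinct of which have conceptual distance $\mathsf{Cd}_\omega^\omega$ equal to $\infty$.
   Context: $\mathcal{L}_\omega^\omega$: languages are sets of relation symbols of finite rank (no function or constant symbols), with equality and variables $v_i$, $i<\omega$; formulas built from $v_i=v_j$ and atomic formulas by $\land,\lnot,\exists v_i$; models are nonempty sets with relations; standard satisfaction. A theory is a set of formulas of a language; $T\models\varphi$ iff $\varphi$ holds in every model of $T$. $T\sqsubseteq T'$ means every formula of $T$'s language is a formula of $T'$'s language and for such $\varphi$, $T'\models\varphi\iff T\models\varphi$. $T\leadsto T'$ iff the language of $T'$ is the language of $T$ together with one relation symbol, and $T\sqsubseteq T'$; $T\sim T'$ iff $T\leadsto T'$ or $T'\leadsto T$. A translation maps $v_i=v_j$ to itself and commutes with $\lnot,\land,\exists v_i$; it is an interpretation of $T$ into $T'$ if theorems of $T$ go to theorems of $T'$. $T,T'$ are definitionally equivalent ($\equiv_\Delta$) if there are interpretations $tr$ of $T$ into $T'$ and $tr'$ of $T'$ into $T$ with $T\models tr'(tr(\varphi))\leftrightarrow\varphi$ and $T'\models tr(tr'(\psi))\leftrightarrow\psi$ for all formulas $\varphi,\psi$. The conceptual distance $\mathsf{Cd}_\omega^\omega(T,T')$ is the least $k$ such that there is a finite chain of theories $T=T_0,\dots,T_m=T'$ with each consecutive pair related by $\equiv_\Delta$ or by $\sim$, exactly $k$ of the steps being $\sim$-steps; it is $\infty$ if no such chain exists. -}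

module Defs where

open import Data.Nat using (ℕ)
open import Data.Nat as ℕ using (_≟_)
open import Data.Fin using (Fin)
open import Data.Product using (Σ; Σ-syntax; ∃; _×_; _,_)
open import Data.Sum using (_⊎_)
open import Data.Empty using (⊥)
open import Relation.Nullary using (¬_; yes; no)
open import Relation.Binary.PropositionalEquality using (_≡_; _≢_; subst; sym)
open import Function using (_∘_)

record Lang : Set₁ where
  field
    Sym   : Set
    arity : Sym → ℕ
open Lang public

data Formula (L : Lang) : Set where
  _≐_  : ℕ → ℕ → Formula L
  atom : (r : Sym L) → (Fin (arity L r) → ℕ) → Formula L
  ¬'_  : Formula L → Formula L
  _∧'_ : Formula L → Formula L → Formula L
  ∃'   : ℕ → Formula L → Formula L

_⇒'_ : ∀ {L} → Formula L → Formula L → Formula L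
φ ⇒' ψ = ¬' (φ ∧' (¬' ψ))

_⇔'_ : ∀ {L} → Formula L → Formula L → Formula L
φ ⇔' ψ = (φ ⇒' ψ) ∧' (ψ ⇒' φ)

record Model (L : Lang) : Set₁ where
  field
    Carrier : Set
    point   : Carrier
    Rel     : (r : Sym L) → (Fin (arity L r) → Carrier) → Set
open Model public

_[_↦_] : {A : Set} → (ℕ → A) → ℕ → A → (ℕ → A)
(s [ i ↦ a ]) j with j ≟ i
... | yes _ = a
... | no  _ = s j

-- Standard (classical) satisfaction, rendered in the ¬¬-fragment so that it
-- is the classical Tarskian notion.
Sat : ∀ {L} (M : Model L) → Formula L → (ℕ → Carrier M) → Set
Sat M (i ≐ j)    s = ¬ ¬ (s i ≡ s j)
Sat M (atom r x) s = ¬ ¬ Rel M r (s ∘ x)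
Sat M (¬' φ)     s = ¬ Sat M φ s
Sat M (φ ∧' ψ)   s = Sat M φ s × Sat M ψ s
Sat M (∃' i φ)   s = ¬ ((a : Carrier M) → ¬ Sat M φ (s [ i ↦ a ]))

_⊩_ : ∀ {L} → Model L → Formula L → Set
M ⊩ φ = (s : ℕ → Carrier M) → Sat M φ s

record Theory : Set₁ where
  field
    lang   : Lang
    axioms : Formula lang → Set
open Theory public

_isModelOf_ : ∀ {L} → Model L → (Formula L → Set) → Set
M isModelOf Ax = ∀ ψ → Ax ψ → M ⊩ ψ

_⊨_ : (T : Theory) → Formula (lang T) → Set₁
T ⊨ φ = (M : Model (lang T)) → M isModelOf (axioms T) → M ⊩ φ

record LangEmb (L L' : Lang) : Set where
  field
    emb       : Sym L → Sym L'
    emb-inj   : ∀ {r r'} → emb r ≡ emb r' → r ≡ r'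
    emb-arity : ∀ r → arity L' (emb r) ≡ arity L r
open LangEmb public

embF : ∀ {L L'} → LangEmb L L' → Formula L → Formula L'
embF e (i ≐ j)    = i ≐ j
embF e (atom r x) = atom (emb e r) (subst (λ n → Fin n → ℕ) (sym (emb-arity e r)) x)
embF e (¬' φ)     = ¬' embF e φ
embF e (φ ∧' ψ)   = embF e φ ∧' embF e ψ
embF e (∃' i φ)   = ∃' i (embF e φ)

-- L' is L together with exactly one new relation symbol
record OneMoreSymbol (L L' : Lang) : Set where
  field
    incl    : LangEmb L L'
    new     : Sym L'
    new-new : ∀ r → emb incl r ≢ new
    cover   : ∀ r' → r' ≡ new ⊎ Σ[ r ∈ Sym L ] emb incl r ≡ r'
open OneMoreSymbol public

Sub : (T T' : Theory) → LangEmb (lang T) (lang T') → Set₁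
Sub T T' e = ∀ φ → ((T' ⊨ embF e φ) → (T ⊨ φ)) × ((T ⊨ φ) → (T' ⊨ embF e φ))

_⇝_ : Theory → Theory → Set₁
T ⇝ T' = Σ[ o ∈ OneMoreSymbol (lang T) (lang T') ] Sub T T' (incl o)

_∼_ : Theory → Theory → Set₁
T ∼ T' = (T ⇝ T') ⊎ (T' ⇝ T)

record IsTranslation {L L' : Lang} (tr : Formula L → Formula L') : Set where
  field
    tr-≐ : ∀ i j → tr (i ≐ j) ≡ (i ≐ j)
    tr-¬ : ∀ φ → tr (¬' φ) ≡ ¬' tr φ
    tr-∧ : ∀ φ ψ → tr (φ ∧' ψ) ≡ (tr φ ∧' tr ψ)
    tr-∃ : ∀ i φ → tr (∃' i φ) ≡ ∃' i (tr φ)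

IsInterpretation : (T T' : Theory) → (Formula (lang T) → Formula (lang T')) → Set₁
IsInterpretation T T' tr =
  IsTranslation tr × (∀ φ → T ⊨ φ → T' ⊨ tr φ)

_≡Δ_ : Theory → Theory → Set₁
T ≡Δ T' =
  Σ[ tr  ∈ (Formula (lang T)  → Formula (lang T')) ]
  Σ[ tr' ∈ (Formula (lang T') → Formula (lang T))  ]
    IsInterpretation T T' tr × IsInterpretation T' T tr'
  × (∀ φ → T  ⊨ (tr' (tr φ) ⇔' φ))
  × (∀ ψ → T' ⊨ (tr (tr' ψ) ⇔' ψ))

data Chain : ℕ → Theory → Theory → Set₂ where
  done  : ∀ {T} → Chain 0 T T
  stepΔ : ∀ {k T T₁ T'} → T ≡Δ T₁ → Chain k T₁ T' → Chain k T T'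
  step∼ : ∀ {k T T₁ T'} → T ∼ T₁  → Chain k T₁ T' → Chain (ℕ.suc k) T T'

-- Cd^ω_ω(T, T') = ∞ : there is no such chain at all
CdInfinite : Theory → Theory → Set₂
CdInfinite T T' = ∀ k → ¬ Chain k T T'

module Submission where

open import Defs
open import Data.Nat using (ℕ)
open import Data.Product using (Σ-syntax)
open import Relation.Binary.PropositionalEquality using (_≢_)

open import Data.Empty using (⊥)
open import Data.Fin as Fin using (Fin; toℕ)
open import Data.Fin.Properties using (pigeonhole; toℕ-fromℕ<; toℕ<n)
open import Data.Nat using (zero; suc; _<_; _≤_; z≤n; s≤s; NonZero)
open import Data.Nat.DivMod using (_%_; _mod_; m%n<n; m<n⇒m%n≡m)
open import Data.Nat.Properties
  using (<-cmp; <-irrefl; <-trans; ≤-refl; ≤-trans; ≤-pred; n≤1+n; n<1+n; m<1+n⇒m<n∨m≡n; m≤n⇒m<n∨m≡n)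
open import Data.Product using (_,_; proj₁; proj₂)
open import Data.Sum using (inj₁; inj₂)
open import Function using (_∘_)
open import Function.Bundles using (_⇔_; mk⇔; Equivalence)
open import Function.Construct.Composition using (_⇔-∘_)
open import Function.Construct.Identity using (⇔-id)
open import Function.Construct.Symmetry using (⇔-sym)
open import Relation.Binary using (tri<; tri≈; tri>)
open import Relation.Binary.PropositionalEquality
  using (_≡_; refl; sym; trans; cong; cong₂; subst; module ≡-Reasoning)
open import Relation.Nullary using (¬_)

-- The theories are "there are at most n+1 elements", n ∈ ℕ, in the empty
-- language. A sentence of pure equality is fixed by every translation and by
-- every language inclusion, so along a chain of ≡Δ- and ∼-steps the set of
-- such sentences a theory proves never changes. But "at most m+1 elements"
-- is proved by the m-th theory and refuted in the (n+1)-element model of the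
-- n-th theory when m < n.

L∅ : Lang
L∅ = record { Sym = ⊥ ; arity = λ () }

⌜_⌝ : ∀ {L} → Formula L∅ → Formula L
⌜ i ≐ j ⌝    = i ≐ j
⌜ atom () _ ⌝
⌜ ¬' φ ⌝     = ¬' ⌜ φ ⌝
⌜ φ ∧' ψ ⌝   = ⌜ φ ⌝ ∧' ⌜ ψ ⌝
⌜ ∃' i φ ⌝   = ∃' i ⌜ φ ⌝

translation-fixes-⌜⌝ : ∀ {L L'} {tr : Formula L → Formula L'} →
                       IsTranslation tr → ∀ φ → tr ⌜ φ ⌝ ≡ ⌜ φ ⌝
translation-fixes-⌜⌝ it (i ≐ j)  = IsTranslation.tr-≐ it i j
translation-fixes-⌜⌝ it (¬' φ)   =
  trans (IsTranslation.tr-¬ it _) (cong ¬'_ (translation-fixes-⌜⌝ it φ))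
translation-fixes-⌜⌝ it (φ ∧' ψ) =
  trans (IsTranslation.tr-∧ it _ _)
        (cong₂ _∧'_ (translation-fixes-⌜⌝ it φ) (translation-fixes-⌜⌝ it ψ))
translation-fixes-⌜⌝ it (∃' i φ) =
  trans (IsTranslation.tr-∃ it i _) (cong (∃' i) (translation-fixes-⌜⌝ it φ))

embF-⌜⌝ : ∀ {L L'} (e : LangEmb L L') φ → embF e ⌜ φ ⌝ ≡ ⌜ φ ⌝
embF-⌜⌝ e (i ≐ j)  = refl
embF-⌜⌝ e (¬' φ)   = cong ¬'_ (embF-⌜⌝ e φ)
embF-⌜⌝ e (φ ∧' ψ) = cong₂ _∧'_ (embF-⌜⌝ e φ) (embF-⌜⌝ e ψ)
embF-⌜⌝ e (∃' i φ) = cong (∃' i) (embF-⌜⌝ e φ)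

≡Δ-⊨⌜⌝ : ∀ {T T'} → T ≡Δ T' → ∀ φ → (T ⊨ ⌜ φ ⌝) ⇔ (T' ⊨ ⌜ φ ⌝)
≡Δ-⊨⌜⌝ {T} {T'} (_ , _ , (tr , tr-interprets) , (tr' , tr'-interprets) , _) φ = mk⇔
  (subst (T' ⊨_) (translation-fixes-⌜⌝ tr φ) ∘ tr-interprets ⌜ φ ⌝)
  (subst (T ⊨_) (translation-fixes-⌜⌝ tr' φ) ∘ tr'-interprets ⌜ φ ⌝)

⇝-⊨⌜⌝ : ∀ {T T'} → T ⇝ T' → ∀ φ → (T ⊨ ⌜ φ ⌝) ⇔ (T' ⊨ ⌜ φ ⌝)
⇝-⊨⌜⌝ {T' = T'} (o , conservative) φ = mk⇔
  (subst (T' ⊨_) (embF-⌜⌝ (incl o) φ) ∘ proj₂ (conservative ⌜ φ ⌝))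
  (proj₁ (conservative ⌜ φ ⌝) ∘ subst (T' ⊨_) (sym (embF-⌜⌝ (incl o) φ)))

∼-⊨⌜⌝ : ∀ {T T'} → T ∼ T' → ∀ φ → (T ⊨ ⌜ φ ⌝) ⇔ (T' ⊨ ⌜ φ ⌝)
∼-⊨⌜⌝ (inj₁ T⇝T') φ = ⇝-⊨⌜⌝ T⇝T' φ
∼-⊨⌜⌝ (inj₂ T'⇝T) φ = ⇔-sym (⇝-⊨⌜⌝ T'⇝T φ)

Chain-⊨⌜⌝ : ∀ {k T T'} → Chain k T T' → ∀ φ → (T ⊨ ⌜ φ ⌝) ⇔ (T' ⊨ ⌜ φ ⌝)
Chain-⊨⌜⌝ {T = T} done φ = ⇔-id (T ⊨ ⌜ φ ⌝)
Chain-⊨⌜⌝ (stepΔ T≡ΔT₁ c) φ = Chain-⊨⌜⌝ c φ ⇔-∘ ≡Δ-⊨⌜⌝ T≡ΔT₁ φ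
Chain-⊨⌜⌝ (step∼ T∼T₁ c)  φ = Chain-⊨⌜⌝ c φ ⇔-∘ ∼-⊨⌜⌝ T∼T₁ φ

⊥' : ∀ {L} → Formula L
⊥' = ¬' (0 ≐ 0)

_∨'_ : ∀ {L} → Formula L → Formula L → Formula L
φ ∨' ψ = ¬' ((¬' φ) ∧' (¬' ψ))

EqualsSomeBelow : ℕ → ℕ → Formula L∅
EqualsSomeBelow j zero    = ⊥'
EqualsSomeBelow j (suc i) = EqualsSomeBelow j i ∨' (i ≐ j)

-- v_a ≐ v_b for some a < b ≤ k; as an axiom it says "at most k elements"
HasRepetition : ℕ → Formula L∅
HasRepetition zero    = ⊥'
HasRepetition (suc k) = HasRepetition k ∨' EqualsSomeBelow (suc k) (suc k)

module _ {L : Lang} (M : Model L) (s : ℕ → Carrier M) where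

  sat-EqualsSomeBelow : ∀ {a j} i → a < i → s a ≡ s j →
                        Sat M ⌜ EqualsSomeBelow j i ⌝ s
  sat-EqualsSomeBelow (suc i) a<1+i sa≡sj with m<1+n⇒m<n∨m≡n a<1+i
  ... | inj₁ a<i  = λ neither → proj₁ neither (sat-EqualsSomeBelow i a<i sa≡sj)
  ... | inj₂ refl = λ neither → proj₂ neither (λ sa≢sj → sa≢sj sa≡sj)

  unsat-EqualsSomeBelow : ∀ {j} i → (∀ {a} → a < i → s a ≢ s j) →
                          ¬ Sat M ⌜ EqualsSomeBelow j i ⌝ s
  unsat-EqualsSomeBelow zero    _        sat = sat (λ s0≢s0 → s0≢s0 refl)
  unsat-EqualsSomeBelow (suc i) distinct sat = sat
    ( unsat-EqualsSomeBelow i (λ a<i → distinct (<-trans a<i (n<1+n i)))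
    , λ si≢sj → si≢sj (distinct (n<1+n i)) )

  sat-HasRepetition : ∀ {a b} k → a < b → b ≤ k → s a ≡ s b →
                      Sat M ⌜ HasRepetition k ⌝ s
  sat-HasRepetition zero    () z≤n _
  sat-HasRepetition (suc k) a<b b≤1+k sa≡sb with m≤n⇒m<n∨m≡n b≤1+k
  ... | inj₁ b<1+k = λ neither → proj₁ neither (sat-HasRepetition k a<b (≤-pred b<1+k) sa≡sb)
  ... | inj₂ refl  = λ neither → proj₂ neither (sat-EqualsSomeBelow (suc k) a<b sa≡sb)

  unsat-HasRepetition : ∀ k → (∀ {a b} → a < b → b ≤ k → s a ≢ s b) →
                        ¬ Sat M ⌜ HasRepetition k ⌝ s
  unsat-HasRepetition zero    _        sat = sat (λ s0≢s0 → s0≢s0 refl)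
  unsat-HasRepetition (suc k) distinct sat = sat
    ( unsat-HasRepetition k (λ a<b b≤k → distinct a<b (≤-trans b≤k (n≤1+n k)))
    , unsat-EqualsSomeBelow (suc k) (λ a<1+k → distinct a<1+k ≤-refl) )

mod-injective : ∀ {a b n} .{{_ : NonZero n}} → a < n → b < n →
                a mod n ≡ b mod n → a ≡ b
mod-injective {a} {b} {n} a<n b<n a≡b-mod = begin
  a               ≡⟨ m<n⇒m%n≡m a<n ⟨
  a % n           ≡⟨ toℕ-fromℕ< (m%n<n a n) ⟨
  toℕ (a mod n)   ≡⟨ cong toℕ a≡b-mod ⟩
  toℕ (b mod n)   ≡⟨ toℕ-fromℕ< (m%n<n b n) ⟩
  b % n           ≡⟨ m<n⇒m%n≡m b<n ⟩
  b               ∎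
  where open ≡-Reasoning

AtMost : ℕ → Theory
AtMost n = record { lang = L∅ ; axioms = _≡ ⌜ HasRepetition n ⌝ }

FinModel : ℕ → Model L∅
FinModel n = record { Carrier = Fin (suc n) ; point = Fin.zero ; Rel = λ () }

FinModel⊩HasRepetition : ∀ n → FinModel n ⊩ ⌜ HasRepetition (suc n) ⌝
FinModel⊩HasRepetition n s with pigeonhole (n<1+n (suc n)) (s ∘ toℕ)
... | a , b , a<b , sa≡sb = sat-HasRepetition (FinModel n) s (suc n) a<b (≤-pred (toℕ<n b)) sa≡sb

FinModel⊮HasRepetition : ∀ {m n} → m ≤ n → ¬ FinModel n ⊩ ⌜ HasRepetition m ⌝
FinModel⊮HasRepetition {m} {n} m≤n holds =
  unsat-HasRepetition (FinModel n) (_mod suc n) m distinct (holds (_mod suc n))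
  where
  distinct : ∀ {a b} → a < b → b ≤ m → a mod suc n ≢ b mod suc n
  distinct {a} {b} a<b b≤m same = <-irrefl (mod-injective a<1+n b<1+n same) a<b
    where
    b<1+n : b < suc n
    b<1+n = ≤-trans (s≤s b≤m) (s≤s m≤n)
    a<1+n : a < suc n
    a<1+n = <-trans a<b b<1+n

AtMost⊨HasRepetition : ∀ n → AtMost n ⊨ ⌜ HasRepetition n ⌝
AtMost⊨HasRepetition n _ axioms-hold = axioms-hold _ refl

AtMost⊭HasRepetition : ∀ {m n} → m ≤ n → ¬ AtMost (suc n) ⊨ ⌜ HasRepetition m ⌝
AtMost⊭HasRepetition {n = n} m≤n proves =
  FinModel⊮HasRepetition m≤n (proves (FinModel n) λ { _ refl → FinModel⊩HasRepetition n })

AtMost-not-⊨⌜⌝-equivalent : ∀ {m n} → m < n →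
  ¬ ((AtMost (suc m) ⊨ ⌜ HasRepetition (suc m) ⌝) ⇔ (AtMost (suc n) ⊨ ⌜ HasRepetition (suc m) ⌝))
AtMost-not-⊨⌜⌝-equivalent {m} m<n same =
  AtMost⊭HasRepetition m<n (Equivalence.to same (AtMost⊨HasRepetition (suc m)))

corollary4p13 : Σ[ T ∈ (ℕ → Theory) ] (∀ i j → i ≢ j → CdInfinite (T i) (T j))
corollary4p13 = AtMost ∘ suc , separated
  where
  separated : ∀ i j → i ≢ j → CdInfinite (AtMost (suc i)) (AtMost (suc j))
  separated i j i≢j k chain with <-cmp i j
  ... | tri< i<j _ _ = AtMost-not-⊨⌜⌝-equivalent i<j (Chain-⊨⌜⌝ chain (HasRepetition (suc i)))
  ... | tri≈ _ i≡j _ = i≢j i≡j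
  ... | tri> _ _ j<i = AtMost-not-⊨⌜⌝-equivalent j<i (⇔-sym (Chain-⊨⌜⌝ chain (HasRepetition (suc j))))
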